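{- Let $G$ be a graph, $\mathcal{P}$ a maximal $P_2$-packing of $G$ of size $j$, suppose $G$ has a $P_2$-packing of size $j+1$, and let $\mathcal{Q}\in\mathfrak{Q}_{(2)}$. Then no $q\in\mathcal{Q}$ is foldable (on any $p\in\mathcal{P}$).
   Context: A $P_2$ is a path $p=p_1p_2p_3$ (three vertices, edges $p_1p_2,p_2p_3$; the roles of $p_1,p_3$ may be interchanged). A $P_2$-packing is a set of pairwise vertex-disjoint $P_2$'s in $G$, maximal if no further $P_2$ vertex-disjoint from all members can be added. $V(\cdot)$, $E(\cdot)$ denote vertex/edge sets (unions for sets of paths). $\mathfrak{Q}_{(1)}$ is the set of $P_2$-packings $\mathcal{Q}$ of size $j+1$ maximizing $\sum_{p\in\mathcal{P}}\sum_{q\in\mathcal{Q}}1_{[E(p)=E(q)]}$; $\mathfrak{Q}_{(2)}$ is the set of those $\mathcal{Q}\in\mathfrak{Q}_{(1)}$ maximizing $\sum_{p\in\mathcal{P}}\sum_{q\in\mathcal{Q}}|E(p)\cap E(q)|$. A path $q=q_1q_2q_3\in\mathcal{Q}$ is foldable on $p=p_1p_2p_3\in\mathcal{P}$ if $q_2\in V(p)\cap V(q)$ and, writing $p_s=q_2$ with $s\in\{1,2,3\}$, either $p_{s+1}$ exists and $p_{s+1}\notin V(\mathcal{Q})$, or $p_{s-1}$ exists and $p_{s-1}\notin V(\mathcal{Q})$. -}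

module Defs where

open import Data.Nat using (ℕ; zero; suc; _+_; _≤_)
open import Data.Fin using (Fin; _≟_)
open import Data.Bool using (Bool; true; false; _∧_; _∨_; if_then_else_)
open import Data.List using (List; []; _∷_; length; map; filterᵇ)
open import Data.Bool.ListAction using (any; all)
open import Data.Nat.ListAction using (sum)
open import Data.List.Relation.Unary.AllPairs using (AllPairs)
open import Data.List.Membership.Propositional using (_∈_)
open import Data.Product using (Σ; _×_; _,_; ∃)
open import Data.Sum using (_⊎_)
open import Data.Empty using (⊥)
open import Relation.Nullary using (¬_)
open import Relation.Nullary.Decidable using (⌊_⌋)
open import Relation.Binary.PropositionalEquality using (_≡_; _≢_)

record Graph (n : ℕ) : Set₁ where
  field
    Adj   : Fin n → Fin n → Set
    sym   : ∀ {u v} → Adj u v → Adj v u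
    irrefl : ∀ {u} → ¬ Adj u u
open Graph public

record P2 {n : ℕ} (G : Graph n) : Set where
  constructor mkP2
  field
    p₁ p₂ p₃ : Fin n
    e₁₂ : Adj G p₁ p₂
    e₂₃ : Adj G p₂ p₃
    p₁≢p₃ : p₁ ≢ p₃
open P2 public

module _ {n : ℕ} {G : Graph n} where

  InV : Fin n → P2 G → Set
  InV v p = v ≡ p₁ p ⊎ v ≡ p₂ p ⊎ v ≡ p₃ p

  InVs : Fin n → List (P2 G) → Set
  InVs v Q = ∃ λ q → q ∈ Q × InV v q

  VertexDisjoint : P2 G → P2 G → Set
  VertexDisjoint p q = ∀ v → InV v p → InV v q → ⊥

  -- A P₂-packing: pairwise vertex-disjoint P₂'s (as a list; size = length).
  IsPacking : List (P2 G) → Set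
  IsPacking P = AllPairs VertexDisjoint P

  IsMaximalPacking : List (P2 G) → Set
  IsMaximalPacking P =
    IsPacking P × (∀ (r : P2 G) → ¬ (∀ p → p ∈ P → VertexDisjoint r p))

  -- Edges as unordered pairs {a,b}; edge equality {a,b} = {c,d}.
  sameEdge : Fin n → Fin n → Fin n → Fin n → Bool
  sameEdge a b c d = (⌊ a ≟ c ⌋ ∧ ⌊ b ≟ d ⌋) ∨ (⌊ a ≟ d ⌋ ∧ ⌊ b ≟ c ⌋)

  E : P2 G → List (Fin n × Fin n)
  E p = (p₁ p , p₂ p) ∷ (p₂ p , p₃ p) ∷ []

  edgeIn : Fin n × Fin n → P2 G → Bool
  edgeIn (a , b) q = any (λ { (c , d) → sameEdge a b c d }) (E q)

  sameEdgeSet : P2 G → P2 G → ℕ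
  sameEdgeSet p q =
    if all (λ e → edgeIn e q) (E p) ∧ all (λ e → edgeIn e p) (E q) then 1 else 0

  -- |E(p) ∩ E(q)|  (the two edges of a P₂ are distinct since p₁ ≢ p₃)
  commonEdges : P2 G → P2 G → ℕ
  commonEdges p q = length (filterᵇ (λ e → edgeIn e q) (E p))

  doubleSum : (P2 G → P2 G → ℕ) → List (P2 G) → List (P2 G) → ℕ
  doubleSum f P Q = sum (map (λ p → sum (map (λ q → f p q) Q)) P)

  score₁ score₂ : List (P2 G) → List (P2 G) → ℕ
  score₁ = doubleSum sameEdgeSet
  score₂ = doubleSum commonEdges

  InQ1 : (P : List (P2 G)) (j : ℕ) → List (P2 G) → Set
  InQ1 P j Q = IsPacking Q × length Q ≡ suc j ×
    (∀ Q' → IsPacking Q' → length Q' ≡ suc j → score₁ P Q' ≤ score₁ P Q)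

  InQ2 : (P : List (P2 G)) (j : ℕ) → List (P2 G) → Set
  InQ2 P j Q = InQ1 P j Q × (∀ Q' → InQ1 P j Q' → score₂ P Q' ≤ score₂ P Q)

  Foldable : (Q : List (P2 G)) → P2 G → P2 G → Set
  Foldable Q q p =
      (p₂ q ≡ p₁ p × ¬ InVs (p₂ p) Q)
    ⊎ (p₂ q ≡ p₂ p × (¬ InVs (p₃ p) Q ⊎ ¬ InVs (p₁ p) Q))
    ⊎ (p₂ q ≡ p₃ p × ¬ InVs (p₂ p) Q)

module Submission where

-- Idea (an exchange argument).  If q = q₁uq₃ is foldable on p, then u = q₂ lies on p and
-- p has an edge uw with w ∉ V(𝒬).  Rerouting q through w gives a P₂ q' = xuw with
-- x ∈ {q₁, q₃} such that V(q') ⊆ V(q) ∪ {w} and E(p) ∩ E(q) ⊆ E(q').  Replacing q by q'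
-- in 𝒬 yields a packing 𝒬' of the same size.  Every edge of q contains u, and u lies on
-- no member of 𝒫 other than p, while uw ∈ E(p) ∖ E(q); hence q contributes nothing to
-- score₁, so score₁ does not drop, and score₂ strictly increases (uw is gained at p, no
-- common edge is lost anywhere).  This contradicts the choice 𝒬 ∈ 𝔔₍₂₎.

open import Defs hiding (sym)
open import Data.Nat using (ℕ; suc; _≤_; _<_; z≤n; s≤s)
open import Data.Nat.Properties
  using (≤-refl; ≤-trans; <-≤-trans; <-irrefl; m≤n⇒m≤1+n; m<n⇒m<1+n;
         +-mono-≤; +-mono-<-≤; +-mono-≤-<)
open import Data.Bool using (Bool; true; false; T; _∧_; if_then_else_)
open import Data.Bool.Properties using (T-∧; T-∨)
open import Data.Bool.ListAction using (all)
open import Data.Fin using (Fin; _≟_)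
open import Data.List using (List; []; _∷_; length; map; filterᵇ)
open import Data.List.Membership.Propositional using (_∈_; find)
open import Data.List.Relation.Unary.Any using (Any; here; there)
import Data.List.Relation.Unary.Any as Any
open import Data.List.Relation.Unary.Any.Properties using (any⁺; any⁻)
open import Data.List.Relation.Unary.All using (All; []; _∷_; lookup; tabulate)
open import Data.List.Relation.Unary.All.Properties using (all⁺)
open import Data.List.Relation.Unary.AllPairs using (AllPairs; _∷_)
open import Data.Nat.ListAction using (sum)
open import Data.Product using (∃; _×_; _,_; proj₁; proj₂)
import Data.Product as Product
open import Data.Sum using (_⊎_; inj₁; inj₂)
import Data.Sum as Sum
open import Data.Empty using (⊥; ⊥-elim)
open import Function using (_∘_; _⇔_; mk⇔; Equivalence)
open import Relation.Nullary using (¬_; yes; no)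
open import Relation.Nullary.Decidable using (⌊_⌋; T?; toWitness; fromWitness)
open import Relation.Binary.PropositionalEquality using (_≡_; refl; sym; trans; cong; subst)

data Replace {A : Set} (x y : A) : List A → List A → Set where
  here  : ∀ {zs} → Replace x y (x ∷ zs) (y ∷ zs)
  there : ∀ {z xs ys} → Replace x y xs ys → Replace x y (z ∷ xs) (z ∷ ys)

module _ {A : Set} where

  replace : ∀ {x : A} {xs} (y : A) → x ∈ xs → ∃ λ ys → Replace x y xs ys
  replace y (here refl) = _ , here
  replace y (there x∈xs) = Product.map (_ ∷_) there (replace y x∈xs)

  replace-length : ∀ {x y : A} {xs ys} → Replace x y xs ys → length ys ≡ length xs
  replace-length here = refl
  replace-length (there r) = cong suc (replace-length r)

  replace-sum-≤ : ∀ {x y : A} {xs ys} (f : A → ℕ) → Replace x y xs ys →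
    f x ≤ f y → sum (map f xs) ≤ sum (map f ys)
  replace-sum-≤ f here fx≤fy = +-mono-≤ fx≤fy ≤-refl
  replace-sum-≤ f (there r) fx≤fy = +-mono-≤ ≤-refl (replace-sum-≤ f r fx≤fy)

  replace-sum-< : ∀ {x y : A} {xs ys} (f : A → ℕ) → Replace x y xs ys →
    f x < f y → sum (map f xs) < sum (map f ys)
  replace-sum-< f here fx<fy = +-mono-<-≤ fx<fy ≤-refl
  replace-sum-< f (there r) fx<fy = +-mono-≤-< ≤-refl (replace-sum-< f r fx<fy)

  sum-≤ : (f g : A → ℕ) (xs : List A) → (∀ {x} → x ∈ xs → f x ≤ g x) →
    sum (map f xs) ≤ sum (map g xs)
  sum-≤ f g [] f≤g = z≤n
  sum-≤ f g (x ∷ xs) f≤g = +-mono-≤ (f≤g (here refl)) (sum-≤ f g xs (f≤g ∘ there))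

  sum-< : (f g : A → ℕ) (xs : List A) → (∀ {x} → x ∈ xs → f x ≤ g x) →
    ∀ {x} → x ∈ xs → f x < g x → sum (map f xs) < sum (map g xs)
  sum-< f g (x ∷ xs) f≤g (here refl) fx<gx = +-mono-<-≤ fx<gx (sum-≤ f g xs (f≤g ∘ there))
  sum-< f g (x ∷ xs) f≤g (there m) fz<gz =
    +-mono-≤-< (f≤g (here refl)) (sum-< f g xs (f≤g ∘ there) m fz<gz)

  filterᵇ-length-≤ : (f g : A → Bool) (xs : List A) → (∀ {x} → x ∈ xs → T (f x) → T (g x)) →
    length (filterᵇ f xs) ≤ length (filterᵇ g xs)
  filterᵇ-length-≤ f g [] f⇒g = z≤n
  filterᵇ-length-≤ f g (x ∷ xs) f⇒g
    with f x | g x | f⇒g (here refl) | filterᵇ-length-≤ f g xs (f⇒g ∘ there)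
  ... | true  | true  | _  | ih = s≤s ih
  ... | true  | false | fx⇒gx | _ = ⊥-elim (fx⇒gx _)
  ... | false | true  | _  | ih = m≤n⇒m≤1+n ih
  ... | false | false | _  | ih = ih

  filterᵇ-length-< : (f g : A → Bool) (xs : List A) → (∀ {x} → x ∈ xs → T (f x) → T (g x)) →
    ∀ {x} → x ∈ xs → ¬ T (f x) → T (g x) → length (filterᵇ f xs) < length (filterᵇ g xs)
  filterᵇ-length-< f g (x ∷ xs) f⇒g (here refl) ¬fx gx with f x | g x
  ... | true  | _     = ⊥-elim (¬fx _)
  ... | false | true  = s≤s (filterᵇ-length-≤ f g xs (f⇒g ∘ there))
  filterᵇ-length-< f g (x ∷ xs) f⇒g (there m) ¬fz gz
    with f x | g x | f⇒g (here refl) | filterᵇ-length-< f g xs (f⇒g ∘ there) m ¬fz gz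
  ... | true  | true  | _  | ih = s≤s ih
  ... | true  | false | fx⇒gx | _ = ⊥-elim (fx⇒gx _)
  ... | false | true  | _  | ih = m<n⇒m<1+n ih
  ... | false | false | _  | ih = ih

  all-fails : ∀ (f : A → Bool) {x xs} → x ∈ xs → ¬ T (f x) → ¬ T (all f xs)
  all-fails f {xs = xs} x∈xs ¬fx t = ¬fx (lookup (all⁺ f xs t) x∈xs)

  module _ {R : A → A → Set} where

    replace-All : ∀ {x y z : A} {xs ys} → Replace x y xs ys →
      (R z x → R z y) → All (R z) xs → All (R z) ys
    replace-All here f (rzx ∷ rs) = f rzx ∷ rs
    replace-All (there r) f (rzw ∷ rs) = rzw ∷ replace-All r f rs

    replace-AllPairs : ∀ {x y : A} {xs ys} → Replace x y xs ys →
      (∀ {z} → z ∈ xs → R z x → R z y) → (∀ {z} → z ∈ xs → R x z → R y z) →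
      AllPairs R xs → AllPairs R ys
    replace-AllPairs here _ right (rx ∷ rs) = tabulate (λ m → right (there m) (lookup rx m)) ∷ rs
    replace-AllPairs (there r) left right (rz ∷ rs) =
      replace-All r (left (here refl)) rz ∷ replace-AllPairs r (left ∘ there) (right ∘ there) rs

    AllPairs-lookup : ∀ {xs} {x y : A} → AllPairs R xs → x ∈ xs → y ∈ xs → x ≡ y ⊎ R x y ⊎ R y x
    AllPairs-lookup (_ ∷ _) (here refl) (here refl) = inj₁ refl
    AllPairs-lookup (rx ∷ _) (here refl) (there m) = inj₂ (inj₁ (lookup rx m))
    AllPairs-lookup (rx ∷ _) (there m) (here refl) = inj₂ (inj₂ (lookup rx m))
    AllPairs-lookup (_ ∷ rs) (there m) (there m') = AllPairs-lookup rs m m'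

module _ {n : ℕ} {G : Graph n} where

  Edge : Set
  Edge = Fin n × Fin n

  _≈ₑ_ : Edge → Edge → Set
  (a , b) ≈ₑ (c , d) = (a ≡ c × b ≡ d) ⊎ (a ≡ d × b ≡ c)

  ≈ₑ-refl : ∀ {a b} → (a , b) ≈ₑ (a , b)
  ≈ₑ-refl = inj₁ (refl , refl)

  ≈ₑ-swap : ∀ {a b} → (a , b) ≈ₑ (b , a)
  ≈ₑ-swap = inj₂ (refl , refl)

  ≈ₑ-sym : ∀ {a b c d} → (a , b) ≈ₑ (c , d) → (c , d) ≈ₑ (a , b)
  ≈ₑ-sym (inj₁ (refl , refl)) = ≈ₑ-refl
  ≈ₑ-sym (inj₂ (refl , refl)) = ≈ₑ-swap

  ≈ₑ-trans : ∀ {a b c d e f} → (a , b) ≈ₑ (c , d) → (c , d) ≈ₑ (e , f) → (a , b) ≈ₑ (e , f)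
  ≈ₑ-trans (inj₁ (refl , refl)) s = s
  ≈ₑ-trans (inj₂ (refl , refl)) (inj₁ (refl , refl)) = ≈ₑ-swap
  ≈ₑ-trans (inj₂ (refl , refl)) (inj₂ (refl , refl)) = ≈ₑ-refl

  ≈ₑ-through : ∀ {a u b} → (a , u) ≈ₑ (u , b) → a ≡ b
  ≈ₑ-through (inj₁ (a≡u , u≡b)) = trans a≡u u≡b
  ≈ₑ-through (inj₂ (a≡b , _)) = a≡b

  ≈ₑ-from : ∀ {u a b} → (u , a) ≈ₑ (u , b) → a ≡ b
  ≈ₑ-from (inj₁ (_ , a≡b)) = a≡b
  ≈ₑ-from (inj₂ (u≡b , a≡u)) = trans a≡u u≡b

  orientation⇔ : ∀ {a b c d : Fin n} → T (⌊ a ≟ c ⌋ ∧ ⌊ b ≟ d ⌋) ⇔ (a ≡ c × b ≡ d)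
  orientation⇔ {a} {b} {c} {d} = mk⇔
    (Product.map (toWitness {a? = a ≟ c}) (toWitness {a? = b ≟ d}) ∘ Equivalence.to T-∧)
    (Equivalence.from T-∧ ∘ Product.map (fromWitness {a? = a ≟ c}) (fromWitness {a? = b ≟ d}))

  sameEdge-sound : ∀ {a b c d} → T (sameEdge {G = G} a b c d) → (a , b) ≈ₑ (c , d)
  sameEdge-sound {a} {b} {c} {d} t =
    Sum.map (Equivalence.to orientation⇔) (Equivalence.to orientation⇔)
      (Equivalence.to (T-∨ {⌊ a ≟ c ⌋ ∧ ⌊ b ≟ d ⌋}) t)

  sameEdge-complete : ∀ {a b c d} → (a , b) ≈ₑ (c , d) → T (sameEdge {G = G} a b c d)
  sameEdge-complete {a} {b} {c} {d} =
    Equivalence.from (T-∨ {⌊ a ≟ c ⌋ ∧ ⌊ b ≟ d ⌋})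
      ∘ Sum.map (Equivalence.from orientation⇔) (Equivalence.from orientation⇔)

  data _∈E_ (e : Edge) (r : P2 G) : Set where
    first  : e ≈ₑ (p₁ r , p₂ r) → e ∈E r
    second : e ≈ₑ (p₂ r , p₃ r) → e ∈E r

  ∈E⇒Any : ∀ {e r} → e ∈E r → Any (e ≈ₑ_) (E r)
  ∈E⇒Any (first s) = here s
  ∈E⇒Any (second s) = there (here s)

  Any⇒∈E : ∀ {e r} → Any (e ≈ₑ_) (E r) → e ∈E r
  Any⇒∈E (here s) = first s
  Any⇒∈E (there (here s)) = second s

  edgeIn-sound : ∀ e r → T (edgeIn e r) → e ∈E r
  edgeIn-sound (a , b) r = Any⇒∈E ∘ Any.map sameEdge-sound ∘ any⁻ _ (E r)

  edgeIn-complete : ∀ e r → e ∈E r → T (edgeIn e r)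
  edgeIn-complete (a , b) r = any⁺ _ ∘ Any.map sameEdge-complete ∘ ∈E⇒Any

  E⊆∈E : ∀ {e} r → e ∈ E r → e ∈E r
  E⊆∈E r = Any⇒∈E ∘ Any.map λ { refl → ≈ₑ-refl }

  ∈E-resp : ∀ {a b c d r} → (a , b) ≈ₑ (c , d) → (a , b) ∈E r → (c , d) ∈E r
  ∈E-resp s (first t) = first (≈ₑ-trans (≈ₑ-sym s) t)
  ∈E-resp s (second t) = second (≈ₑ-trans (≈ₑ-sym s) t)

  ∈E-endpoints : ∀ {a b r} → (a , b) ∈E r → InV a r × InV b r
  ∈E-endpoints (first (inj₁ (refl , refl))) = inj₁ refl , inj₂ (inj₁ refl)
  ∈E-endpoints (first (inj₂ (refl , refl))) = inj₂ (inj₁ refl) , inj₁ refl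
  ∈E-endpoints (second (inj₁ (refl , refl))) = inj₂ (inj₁ refl) , inj₂ (inj₂ refl)
  ∈E-endpoints (second (inj₂ (refl , refl))) = inj₂ (inj₂ refl) , inj₂ (inj₁ refl)

  ∈E-centre : ∀ {a b r} → (a , b) ∈E r → a ≡ p₂ r ⊎ b ≡ p₂ r
  ∈E-centre (first (inj₁ (_ , b≡))) = inj₂ b≡
  ∈E-centre (first (inj₂ (a≡ , _))) = inj₁ a≡
  ∈E-centre (second (inj₁ (a≡ , _))) = inj₁ a≡
  ∈E-centre (second (inj₂ (_ , b≡))) = inj₂ b≡

  ∈E-adj : ∀ {a b r} → (a , b) ∈E r → Adj G a b
  ∈E-adj {r = r} (first (inj₁ (refl , refl))) = e₁₂ r
  ∈E-adj {r = r} (first (inj₂ (refl , refl))) = Graph.sym G (e₁₂ r)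
  ∈E-adj {r = r} (second (inj₁ (refl , refl))) = e₂₃ r
  ∈E-adj {r = r} (second (inj₂ (refl , refl))) = Graph.sym G (e₂₃ r)

  ∈E-pigeonhole : ∀ {a b c d e f r} → (a , b) ∈E r → (c , d) ∈E r → (e , f) ∈E r →
    (a , b) ≈ₑ (c , d) ⊎ (a , b) ≈ₑ (e , f) ⊎ (c , d) ≈ₑ (e , f)
  ∈E-pigeonhole (first x) (first y) _ = inj₁ (≈ₑ-trans x (≈ₑ-sym y))
  ∈E-pigeonhole (second x) (second y) _ = inj₁ (≈ₑ-trans x (≈ₑ-sym y))
  ∈E-pigeonhole (first x) (second _) (first z) = inj₂ (inj₁ (≈ₑ-trans x (≈ₑ-sym z)))
  ∈E-pigeonhole (second x) (first _) (second z) = inj₂ (inj₁ (≈ₑ-trans x (≈ₑ-sym z)))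
  ∈E-pigeonhole (first _) (second y) (second z) = inj₂ (inj₂ (≈ₑ-trans y (≈ₑ-sym z)))
  ∈E-pigeonhole (second _) (first y) (first z) = inj₂ (inj₂ (≈ₑ-trans y (≈ₑ-sym z)))

  sameEdgeSet-zero : ∀ {e : Edge} (p r : P2 G) → e ∈ E p → ¬ T (edgeIn e r) →
    sameEdgeSet p r ≡ 0
  sameEdgeSet-zero p r e∈p e∉r = indicator-zero (all-fails (λ e → edgeIn e r) e∈p e∉r)
    where
    indicator-zero : ∀ {b c} → ¬ T b → (if b ∧ c then 1 else 0) ≡ 0
    indicator-zero {false} _ = refl
    indicator-zero {true} ¬t = ⊥-elim (¬t _)

  packing-unique : ∀ {P : List (P2 G)} {p p' v} → IsPacking P → p ∈ P → p' ∈ P →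
    InV v p → InV v p' → p' ≡ p
  packing-unique packP p∈P p'∈P v∈p v∈p' with AllPairs-lookup packP p'∈P p∈P
  ... | inj₁ p'≡p = p'≡p
  ... | inj₂ (inj₁ disjoint) = ⊥-elim (disjoint _ v∈p' v∈p)
  ... | inj₂ (inj₂ disjoint) = ⊥-elim (disjoint _ v∈p v∈p')

  doubleSum-≤ : ∀ (f : P2 G → P2 G → ℕ) P {q q' Q Q'} → Replace q q' Q Q' →
    (∀ {p} → p ∈ P → f p q ≤ f p q') → doubleSum f P Q ≤ doubleSum f P Q'
  doubleSum-≤ f P r f≤ = sum-≤ _ _ P (λ p∈P → replace-sum-≤ (f _) r (f≤ p∈P))

  doubleSum-< : ∀ (f : P2 G → P2 G → ℕ) P {q q' Q Q'} → Replace q q' Q Q' →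
    (∀ {p} → p ∈ P → f p q ≤ f p q') → ∀ {p} → p ∈ P → f p q < f p q' →
    doubleSum f P Q < doubleSum f P Q'
  doubleSum-< f P r f≤ p∈P f< =
    sum-< _ _ P (λ p'∈P → replace-sum-≤ (f _) r (f≤ p'∈P)) p∈P (replace-sum-< (f _) r f<)

  Q2-optimal : ∀ {P Q Q' : List (P2 G)} {j : ℕ} → InQ2 P j Q →
    IsPacking Q' → length Q' ≡ length Q →
    score₁ P Q ≤ score₁ P Q' → score₂ P Q < score₂ P Q' → ⊥
  Q2-optimal {P} {Q' = Q'} {j} ((_ , lenQ , max₁) , max₂) packQ' lenQ' score₁≤ score₂< =
    <-irrefl refl (<-≤-trans score₂< (max₂ Q' Q'∈Q1))
    where
    Q'∈Q1 : InQ1 P j Q'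
    Q'∈Q1 = packQ' , trans lenQ' lenQ ,
      λ Q'' packQ'' lenQ'' → ≤-trans (max₁ Q'' packQ'' lenQ'') score₁≤

  module Exchange {P Q : List (P2 G)} (packP : IsPacking P) {p q : P2 G}
                  (p∈P : p ∈ P) (q∈Q : q ∈ Q) {w : Fin n}
                  (uw∈p : (p₂ q , w) ∈E p) (w∉Q : ¬ InVs w Q) where

    w∉q : ¬ InV w q
    w∉q w∈q = w∉Q (q , q∈Q , w∈q)

    uw∉q : ¬ (p₂ q , w) ∈E q
    uw∉q = w∉q ∘ proj₂ ∘ ∈E-endpoints

    record Rerouting : Set where
      field
        path     : P2 G
        vertices : ∀ {v} → InV v path → InV v q ⊎ v ≡ w
        new-edge : (p₂ q , w) ∈E path
        keeps    : ∀ {a b} → (a , b) ∈E p → (a , b) ∈E q → (a , b) ∈E path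

    detour : (x : Fin n) → Adj G x (p₂ q) → InV x q → P2 G
    detour x xu x∈q =
      mkP2 x (p₂ q) w xu (∈E-adj uw∈p) (λ x≡w → w∉q (subst (λ y → InV y q) x≡w x∈q))

    detour-vertices : ∀ x xu x∈q {v} → InV v (detour x xu x∈q) → InV v q ⊎ v ≡ w
    detour-vertices x xu x∈q (inj₁ refl) = inj₁ x∈q
    detour-vertices x xu x∈q (inj₂ (inj₁ refl)) = inj₁ (inj₂ (inj₁ refl))
    detour-vertices x xu x∈q (inj₂ (inj₂ refl)) = inj₂ refl

    -- Take x = q₁ if q₁u is an edge of p (then p = q₁uw), and x = q₃ otherwise.
    reroute : Rerouting
    reroute with T? (edgeIn (p₁ q , p₂ q) p)
    ... | yes q₁u∈p = record
      { path = detour (p₁ q) (e₁₂ q) q₁∈q ; vertices = detour-vertices (p₁ q) (e₁₂ q) q₁∈q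
      ; new-edge = second ≈ₑ-refl ; keeps = keep }
      where
      q₁∈q : InV (p₁ q) q
      q₁∈q = inj₁ refl
      -- p already has the edges q₁u and uw, so uq₃ cannot be a third one.
      keep : ∀ {a b} → (a , b) ∈E p → (a , b) ∈E q → (a , b) ∈E detour (p₁ q) (e₁₂ q) q₁∈q
      keep _ (first s) = first s
      keep ab∈p (second s)
        with ∈E-pigeonhole (edgeIn-sound _ p q₁u∈p) ab∈p uw∈p
      ... | inj₁ s' = ⊥-elim (p₁≢p₃ q (≈ₑ-through (≈ₑ-trans s' s)))
      ... | inj₂ (inj₁ s') = ⊥-elim (w∉q (inj₁ (sym (≈ₑ-through s'))))
      ... | inj₂ (inj₂ s') = ⊥-elim (w∉q (inj₂ (inj₂ (sym (≈ₑ-from (≈ₑ-trans (≈ₑ-sym s) s'))))))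
    ... | no q₁u∉p = record
      { path = detour (p₃ q) (Graph.sym G (e₂₃ q)) q₃∈q
      ; vertices = detour-vertices (p₃ q) (Graph.sym G (e₂₃ q)) q₃∈q
      ; new-edge = second ≈ₑ-refl ; keeps = keep }
      where
      q₃∈q : InV (p₃ q) q
      q₃∈q = inj₂ (inj₂ refl)
      -- the only edge q may share with p is uq₃, which is kept as q₃u.
      keep : ∀ {a b} → (a , b) ∈E p → (a , b) ∈E q →
        (a , b) ∈E detour (p₃ q) (Graph.sym G (e₂₃ q)) q₃∈q
      keep ab∈p (first s) = ⊥-elim (q₁u∉p (edgeIn-complete _ p (∈E-resp s ab∈p)))
      keep _ (second s) = first (≈ₑ-trans s ≈ₑ-swap)

    open Rerouting reroute

    Q' : List (P2 G)
    Q' = proj₁ (replace path q∈Q)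

    Q→Q' : Replace q path Q Q'
    Q→Q' = proj₂ (replace path q∈Q)

    shared-on-q : ∀ {r v} → r ∈ Q → InV v r → InV v path → InV v q
    shared-on-q r∈Q v∈r v∈q' with vertices v∈q'
    ... | inj₁ v∈q = v∈q
    ... | inj₂ refl = ⊥-elim (w∉Q (_ , r∈Q , v∈r))

    Q'-packing : IsPacking Q → IsPacking Q'
    Q'-packing = replace-AllPairs Q→Q'
      (λ r∈Q r#q v v∈r v∈q' → r#q v v∈r (shared-on-q r∈Q v∈r v∈q'))
      (λ r∈Q q#r v v∈q' v∈r → q#r v (shared-on-q r∈Q v∈r v∈q') v∈r)

    -- Every edge of q contains u, and u lies on p only: p is the only member of 𝒫
    -- sharing an edge with q.
    only-p : ∀ {p' e} → p' ∈ P → e ∈ E p' → T (edgeIn e q) → p' ≡ p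
    only-p {p'} {a , b} p'∈P e∈p' e∈q =
      packing-unique packP p∈P p'∈P (proj₁ (∈E-endpoints uw∈p)) u∈p'
      where
      endpoints : InV a p' × InV b p'
      endpoints = ∈E-endpoints (E⊆∈E p' e∈p')
      u∈p' : InV (p₂ q) p'
      u∈p' with ∈E-centre (edgeIn-sound _ q e∈q)
      ... | inj₁ a≡u = subst (λ v → InV v p') a≡u (proj₁ endpoints)
      ... | inj₂ b≡u = subst (λ v → InV v p') b≡u (proj₂ endpoints)

    keeps-edges : ∀ {p' e} → p' ∈ P → e ∈ E p' → T (edgeIn e q) → T (edgeIn e path)
    keeps-edges p'∈P e∈p' e∈q with only-p p'∈P e∈p' e∈q
    ... | refl = edgeIn-complete _ path (keeps (E⊆∈E p e∈p') (edgeIn-sound _ q e∈q))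

    -- The edge uw, as it is listed in E(p): lost by q, gained by q'.
    uw-listed : ∃ λ e₀ → e₀ ∈ E p × (p₂ q , w) ≈ₑ e₀
    uw-listed = find (∈E⇒Any uw∈p)

    e₀ : Edge
    e₀ = proj₁ uw-listed

    e₀∈p : e₀ ∈ E p
    e₀∈p = proj₁ (proj₂ uw-listed)

    e₀∉q : ¬ T (edgeIn e₀ q)
    e₀∉q e₀∈q = uw∉q (∈E-resp (≈ₑ-sym (proj₂ (proj₂ uw-listed))) (edgeIn-sound _ q e₀∈q))

    e₀∈q' : T (edgeIn e₀ path)
    e₀∈q' = edgeIn-complete _ path (∈E-resp (proj₂ (proj₂ uw-listed)) new-edge)

    sameEdgeSet-vanishes : ∀ {p'} → p' ∈ P → sameEdgeSet p' q ≡ 0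
    sameEdgeSet-vanishes {p'} p'∈P with T? (edgeIn (p₁ p' , p₂ p') q)
    ... | no e₁∉q = sameEdgeSet-zero p' q (here refl) e₁∉q
    ... | yes e₁∈q with only-p p'∈P (here refl) e₁∈q
    ...   | refl = sameEdgeSet-zero p q e₀∈p e₀∉q

    score₁-≤ : score₁ P Q ≤ score₁ P Q'
    score₁-≤ = doubleSum-≤ sameEdgeSet P Q→Q'
      (λ {p'} p'∈P → subst (_≤ sameEdgeSet p' path) (sym (sameEdgeSet-vanishes p'∈P)) z≤n)

    score₂-< : score₂ P Q < score₂ P Q'
    score₂-< = doubleSum-< commonEdges P Q→Q'
      (λ p'∈P → filterᵇ-length-≤ _ _ _ (keeps-edges p'∈P))
      p∈P (filterᵇ-length-< _ _ _ (keeps-edges p∈P) e₀∈p e₀∉q e₀∈q')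

    not-in-Q2 : ∀ {j} → ¬ InQ2 P j Q
    not-in-Q2 inQ2 =
      Q2-optimal {P} inQ2 (Q'-packing (proj₁ (proj₁ inQ2))) (replace-length Q→Q') score₁-≤ score₂-<

  foldable⇒exit : ∀ {Q : List (P2 G)} {q p} → Foldable Q q p →
    ∃ λ w → (p₂ q , w) ∈E p × ¬ InVs w Q
  foldable⇒exit {p = p} (inj₁ (u≡p₁ , p₂∉Q)) = p₂ p , first (inj₁ (u≡p₁ , refl)) , p₂∉Q
  foldable⇒exit {p = p} (inj₂ (inj₁ (u≡p₂ , inj₁ p₃∉Q))) = p₃ p , second (inj₁ (u≡p₂ , refl)) , p₃∉Q
  foldable⇒exit {p = p} (inj₂ (inj₁ (u≡p₂ , inj₂ p₁∉Q))) = p₁ p , first (inj₂ (u≡p₂ , refl)) , p₁∉Q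
  foldable⇒exit {p = p} (inj₂ (inj₂ (u≡p₃ , p₂∉Q))) = p₂ p , second (inj₂ (u≡p₃ , refl)) , p₂∉Q

lemma7 : ∀ {n : ℕ} (G : Graph n) (P : List (P2 G)) (j : ℕ) →
    IsMaximalPacking P → length P ≡ j →
    (∃ λ (Q₀ : List (P2 G)) → IsPacking Q₀ × length Q₀ ≡ suc j) →
    (Q : List (P2 G)) → InQ2 P j Q →
    ∀ q → q ∈ Q → ∀ p → p ∈ P → ¬ Foldable Q q p
lemma7 G P j (packP , _) _ _ Q inQ2 q q∈Q p p∈P foldable =
  let (w , uw∈p , w∉Q) = foldable⇒exit {Q = Q} {q} {p} foldable
  in Exchange.not-in-Q2 packP p∈P q∈Q uw∈p w∉Q inQ2
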